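{- Fix $(p,q)\in\mathbb{N}^2$ and $n\in\mathbb{N}$ with $n\ge p+q$, and let $G\subset\{n-q,\ldots,n-1\}$ be nonempty. Define $$A_G=\{F\in S^{p/q}_n : G\cap F=\emptyset\}.$$ Then $|A_G|=|S^{p/q}_{n-|G|}|$.
   Context: $\mathbb{N}=\{1,2,3,\dots\}$. For $(p,q)\in\mathbb{N}^2$ and $m\in\mathbb{N}$, define $$S^{p/q}_m=\{F\subset\mathbb{N} : F \text{ finite nonempty},\ q\min F\ge p|F| \text{ and } \max F=m\},$$ where $|F|$ denotes the cardinality of $F$. -}

module Defs where

open import Data.Nat using (ℕ; zero; suc; _+_; _*_; _∸_; _≤_; _≤ᵇ_)
open import Data.Nat.Properties using (_≟_)
open import Data.Bool using (Bool; true; false; _∧_; not)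
open import Data.Fin using (Fin; toℕ)
open import Data.Fin.Subset using (Subset; ∣_∣; _∈_)
open import Data.Vec using (Vec; []; _∷_; map; _++_)
open import Data.List using (List; []; _∷_; length; filterᵇ; concatMap)
open import Data.Product using (_×_; ∃-syntax)
open import Data.Maybe using (Maybe; just; nothing)
open import Relation.Binary.PropositionalEquality using (_≡_)
open import Relation.Nullary.Decidable using (⌊_⌋)

-- A finite subset of {1,…,m} is encoded as  F : Subset m  (a Vec Bool m);
-- the Fin m index i stands for the natural number  toℕ i + 1.
elemℕ : {m : ℕ} → Fin m → ℕ
elemℕ i = suc (toℕ i)

allSubsets : (m : ℕ) → List (Subset m)
allSubsets zero = [] ∷ []
allSubsets (suc m) = concatMap (λ s → (true ∷ s) ∷ (false ∷ s) ∷ []) (allSubsets m)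

-- Minimum of the encoded set of naturals (nothing if empty); offset k
-- is the number represented by the head position.
minFrom : {m : ℕ} → ℕ → Subset m → Maybe ℕ
minFrom k [] = nothing
minFrom k (true ∷ s) = just k
minFrom k (false ∷ s) = minFrom (suc k) s

minS : {m : ℕ} → Subset m → Maybe ℕ
minS = minFrom 1

maxFrom : {m : ℕ} → ℕ → Subset m → Maybe ℕ
maxFrom k [] = nothing
maxFrom k (b ∷ s) with maxFrom (suc k) s
... | just x = just x
... | nothing with b
...   | true = just k
...   | false = nothing

maxS : {m : ℕ} → Subset m → Maybe ℕ
maxS = maxFrom 1

-- Boolean test for "F ∈ S^{p/q}_m" for F ⊆ {1,…,m} given as Subset m:
-- F nonempty, q·min F ≥ p·|F| and max F = m.
isS : (p q m : ℕ) → Subset m → Bool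
isS p q m F with minS F | maxS F
... | just mn | just mx = ((p * ∣ F ∣) ≤ᵇ (q * mn)) ∧ ⌊ mx ≟ m ⌋
... | _ | _ = false

-- Every member of S^{p/q}_m is a subset of {1,…,m} (its max is m), so
-- S^{p/q}_m is exactly the set of F : Subset m passing isS; its cardinality:
cardS : (p q m : ℕ) → ℕ
cardS p q m = length (filterᵇ (isS p q m) (allSubsets m))

disjointᵇ : {n : ℕ} → Subset n → Subset n → Bool
disjointᵇ [] [] = true
disjointᵇ (g ∷ G) (f ∷ F) = not (g ∧ f) ∧ disjointᵇ G F

cardA : (p q n : ℕ) → Subset n → ℕ
cardA p q n G = length (filterᵇ (λ F → isS p q n F ∧ disjointᵇ G F) (allSubsets n))

InWindow : (q n : ℕ) → Subset n → Set
InWindow q n G = ∀ (i : Fin n) → i ∈ G → (n ∸ q ≤ elemℕ i) × (suc (elemℕ i) ≤ n)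

NonemptyS : {n : ℕ} → Subset n → Set
NonemptyS {n} G = ∃[ i ] (i ∈ G)

-- Deleting the positions of G is a bijection from the subsets of {1,…,n} that avoid G onto
-- the subsets of {1,…,n−|G|}; it preserves cardinality and, since n ∉ G, the property of
-- having maximum n.  It also preserves the condition q·min F ≥ p·|F|: if min F < n−q the
-- minimum is untouched, and otherwise both F and its image lie above n−q ≥ p and have at
-- most q elements, so the condition holds for both.
module Submission where

open import Defs
open import Data.Nat
open import Data.Nat.Properties
open import Data.Bool using (Bool; true; false; _∧_; if_then_else_)
open import Data.Bool.Properties using (∧-zeroʳ; ∧-identityʳ; ∧-comm; T-≡)
import Data.Fin as Fin
open import Data.Fin using (toℕ; fromℕ)
open import Data.Fin.Properties using (toℕ-fromℕ)
open import Data.Fin.Subset using (Subset; ∣_∣; _∈_; ∁)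
open import Data.Fin.Subset.Properties using (∣p∣≤n; ∣∁p∣≡n∸∣p∣; x∈p⇒∣p-x∣<∣p∣)
open import Data.Vec using ([]; _∷_; lookup; here; there)
open import Data.Vec.Properties using (lookup⇒[]=)
open import Data.List using (List; []; _∷_; length; filterᵇ; concatMap)
open import Data.Maybe using (Maybe; just; nothing; _<∣>_)
open import Data.Maybe.Properties using (just-injective)
open import Data.Product using (_,_; proj₁; proj₂)
open import Function using (_∘_; Equivalence)
open import Relation.Binary.PropositionalEquality
open import Relation.Nullary using (yes; no; contradiction)
open import Relation.Nullary.Decidable using (⌊_⌋; isYes≗does; dec-true; dec-false)

countSubsets : (m : ℕ) → (Subset m → Bool) → ℕ
countSubsets m P = length (filterᵇ P (allSubsets m))

length-filterᵇ-doubling : ∀ {m} (P : Subset (suc m) → Bool) (xs : List (Subset m)) →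
  length (filterᵇ P (concatMap (λ s → (true ∷ s) ∷ (false ∷ s) ∷ []) xs))
    ≡ length (filterᵇ (P ∘ (true ∷_)) xs) + length (filterᵇ (P ∘ (false ∷_)) xs)
length-filterᵇ-doubling P [] = refl
length-filterᵇ-doubling P (x ∷ xs) with P (true ∷ x)
length-filterᵇ-doubling P (x ∷ xs) | true with P (false ∷ x)
... | true  = cong suc (trans (cong suc (length-filterᵇ-doubling P xs)) (sym (+-suc _ _)))
... | false = cong suc (length-filterᵇ-doubling P xs)
length-filterᵇ-doubling P (x ∷ xs) | false with P (false ∷ x)
... | true  = trans (cong suc (length-filterᵇ-doubling P xs)) (sym (+-suc _ _))
... | false = length-filterᵇ-doubling P xs

countSubsets-suc : ∀ m (P : Subset (suc m) → Bool) →
  countSubsets (suc m) P ≡ countSubsets m (P ∘ (true ∷_)) + countSubsets m (P ∘ (false ∷_))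
countSubsets-suc m P = length-filterᵇ-doubling P (allSubsets m)

countSubsets-cong : ∀ m {P Q : Subset m → Bool} → (∀ F → P F ≡ Q F) →
  countSubsets m P ≡ countSubsets m Q
countSubsets-cong zero {P} {Q} P≗Q with P [] | Q [] | P≗Q []
... | true  | _ | refl = refl
... | false | _ | refl = refl
countSubsets-cong (suc m) {P} {Q} P≗Q = begin
  countSubsets (suc m) P
    ≡⟨ countSubsets-suc m P ⟩
  countSubsets m (P ∘ (true ∷_)) + countSubsets m (P ∘ (false ∷_))
    ≡⟨ cong₂ _+_ (countSubsets-cong m (P≗Q ∘ (true ∷_))) (countSubsets-cong m (P≗Q ∘ (false ∷_))) ⟩
  countSubsets m (Q ∘ (true ∷_)) + countSubsets m (Q ∘ (false ∷_))
    ≡⟨ countSubsets-suc m Q ⟨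
  countSubsets (suc m) Q ∎
  where open ≡-Reasoning

countSubsets-false : ∀ m {P : Subset m → Bool} → (∀ F → P F ≡ false) → countSubsets m P ≡ 0
countSubsets-false zero {P} P≗false with P [] | P≗false []
... | _ | refl = refl
countSubsets-false (suc m) {P} P≗false =
  trans (countSubsets-suc m P)
        (cong₂ _+_ (countSubsets-false m (P≗false ∘ (true ∷_)))
                   (countSubsets-false m (P≗false ∘ (false ∷_))))

deletePositions : ∀ {m} (G : Subset m) → Subset m → Subset ∣ ∁ G ∣
deletePositions []          []      = []
deletePositions (true  ∷ G) (_ ∷ F) = deletePositions G F
deletePositions (false ∷ G) (b ∷ F) = b ∷ deletePositions G F

countSubsets-deletePositions : ∀ {m} (G : Subset m) (P : Subset ∣ ∁ G ∣ → Bool) →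
  countSubsets m (λ F → P (deletePositions G F) ∧ disjointᵇ G F) ≡ countSubsets ∣ ∁ G ∣ P
countSubsets-deletePositions [] P =
  countSubsets-cong 0 {λ F → P (deletePositions [] F) ∧ disjointᵇ [] F} {P}
    λ { [] → ∧-identityʳ (P []) }
countSubsets-deletePositions {suc m} (false ∷ G) P =
  trans (countSubsets-suc m _)
        (trans (cong₂ _+_ (countSubsets-deletePositions G (P ∘ (true ∷_)))
                          (countSubsets-deletePositions G (P ∘ (false ∷_))))
               (sym (countSubsets-suc ∣ ∁ G ∣ P)))
countSubsets-deletePositions {suc m} (true ∷ G) P =
  trans (countSubsets-suc m _)
        (cong₂ _+_ (countSubsets-false m (λ F → ∧-zeroʳ (P (deletePositions G F))))
                   (countSubsets-deletePositions G P))

countSubsets-disjoint : ∀ {m} (G : Subset m) (P : Subset m → Bool) (Q : Subset ∣ ∁ G ∣ → Bool) →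
  (∀ F → disjointᵇ G F ≡ true → P F ≡ Q (deletePositions G F)) →
  countSubsets m (λ F → P F ∧ disjointᵇ G F) ≡ countSubsets ∣ ∁ G ∣ Q
countSubsets-disjoint {m} G P Q P≗Q =
  trans (countSubsets-cong m transport) (countSubsets-deletePositions G Q)
  where
  transport : ∀ F → P F ∧ disjointᵇ G F ≡ Q (deletePositions G F) ∧ disjointᵇ G F
  transport F with disjointᵇ G F in disjoint
  ... | true  = cong (_∧ true) (P≗Q F disjoint)
  ... | false = trans (∧-zeroʳ (P F)) (sym (∧-zeroʳ _))

disjoint⇒∣F∣≤∣∁G∣ : ∀ {m} (G F : Subset m) → disjointᵇ G F ≡ true → ∣ F ∣ ≤ ∣ ∁ G ∣
disjoint⇒∣F∣≤∣∁G∣ []          []          _ = z≤n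
disjoint⇒∣F∣≤∣∁G∣ (true  ∷ G) (false ∷ F) d = disjoint⇒∣F∣≤∣∁G∣ G F d
disjoint⇒∣F∣≤∣∁G∣ (false ∷ G) (true  ∷ F) d = s≤s (disjoint⇒∣F∣≤∣∁G∣ G F d)
disjoint⇒∣F∣≤∣∁G∣ (false ∷ G) (false ∷ F) d = m≤n⇒m≤1+n (disjoint⇒∣F∣≤∣∁G∣ G F d)

∣deletePositions∣ : ∀ {m} (G F : Subset m) → disjointᵇ G F ≡ true → ∣ deletePositions G F ∣ ≡ ∣ F ∣
∣deletePositions∣ []          []          _ = refl
∣deletePositions∣ (true  ∷ G) (false ∷ F) d = ∣deletePositions∣ G F d
∣deletePositions∣ (false ∷ G) (true  ∷ F) d = cong suc (∣deletePositions∣ G F d)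
∣deletePositions∣ (false ∷ G) (false ∷ F) d = ∣deletePositions∣ G F d

hasTop : ∀ {m} → Subset m → Bool
hasTop {zero}  _ = false
hasTop {suc m} F = lookup F (fromℕ m)

hasTop-∷ : ∀ {m} b (F : Subset m) → 0 < m → hasTop (b ∷ F) ≡ hasTop F
hasTop-∷ b (_ ∷ _) _ = refl

¬hasTop⇒0<∣∁G∣ : ∀ {m} (G : Subset (suc m)) → hasTop G ≡ false → 0 < ∣ ∁ G ∣
¬hasTop⇒0<∣∁G∣ (false ∷ G)     _   = s≤s z≤n
¬hasTop⇒0<∣∁G∣ (true  ∷ g ∷ G) top = ¬hasTop⇒0<∣∁G∣ (g ∷ G) top

hasTop-deletePositions : ∀ {m} (G F : Subset m) → hasTop G ≡ false →
  hasTop (deletePositions G F) ≡ hasTop F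
hasTop-deletePositions []              []          _   = refl
hasTop-deletePositions (false ∷ [])    (_ ∷ [])    _   = refl
hasTop-deletePositions (true  ∷ g ∷ G) (_ ∷ F)     top = hasTop-deletePositions (g ∷ G) F top
hasTop-deletePositions (false ∷ g ∷ G) (b ∷ F)     top =
  trans (hasTop-∷ b (deletePositions (g ∷ G) F) (¬hasTop⇒0<∣∁G∣ (g ∷ G) top))
        (hasTop-deletePositions (g ∷ G) F top)

window⇒¬hasTop : ∀ q {n} (G : Subset n) → InWindow q n G → hasTop G ≡ false
window⇒¬hasTop q {zero}  []  _      = refl
window⇒¬hasTop q {suc m} G window with hasTop G in top
... | false = refl
... | true  = contradiction (subst (λ t → suc (suc t) ≤ suc m) (toℕ-fromℕ m) top<n) (1+n≰n {suc m})
  where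
  top<n : suc (suc (toℕ (fromℕ m))) ≤ suc m
  top<n = proj₂ (window (fromℕ m) (lookup⇒[]= (fromℕ m) G top))

minFrom-≥ : ∀ {m} k (F : Subset m) {x} → minFrom k F ≡ just x → k ≤ x
minFrom-≥ k (true  ∷ F) refl = ≤-refl
minFrom-≥ k (false ∷ F) eq   = ≤-trans (n≤1+n k) (minFrom-≥ (suc k) F eq)

minFrom≡nothing⇒¬hasTop : ∀ {m} k (F : Subset m) → minFrom k F ≡ nothing → hasTop F ≡ false
minFrom≡nothing⇒¬hasTop k []              _  = refl
minFrom≡nothing⇒¬hasTop k (false ∷ [])    _  = refl
minFrom≡nothing⇒¬hasTop k (false ∷ c ∷ F) eq = minFrom≡nothing⇒¬hasTop (suc k) (c ∷ F) eq

maxFrom-hasTop : ∀ {m} k (F : Subset m) → hasTop F ≡ true → maxFrom (suc k) F ≡ just (k + m)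
maxFrom-hasTop k (true ∷ [])    _ = cong just (+-comm 1 k)
maxFrom-hasTop {suc (suc m)} k (b ∷ c ∷ F) top
  rewrite maxFrom-hasTop (suc k) (c ∷ F) top = cong just (sym (+-suc k (suc m)))

maxFrom-∷ : ∀ {m} k b (F : Subset m) →
  maxFrom k (b ∷ F) ≡ (maxFrom (suc k) F <∣> (if b then just k else nothing))
maxFrom-∷ k b F with maxFrom (suc k) F
... | just _  = refl
... | nothing with b
...   | true  = refl
...   | false = refl

maxFrom-¬hasTop : ∀ {m} k (F : Subset m) {x} → hasTop F ≡ false → maxFrom (suc k) F ≡ just x →
  x < k + m
maxFrom-¬hasTop k (false ∷ []) _ ()
maxFrom-¬hasTop {suc (suc m)} k (b ∷ F@(_ ∷ _)) top eq
  with maxFrom (suc (suc k)) F | maxFrom-¬hasTop (suc k) F top | trans (sym (maxFrom-∷ (suc k) b F)) eq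
... | just y  | ih | refl = subst (y <_) (sym (+-suc k (suc m))) (ih refl)
maxFrom-¬hasTop {suc (suc m)} k (true ∷ F@(_ ∷ _)) top eq | nothing | _ | refl =
  subst (suc k <_) (sym (+-suc k (suc m))) (s≤s (m<m+n k (s≤s z≤n)))

maxS≡nothing⇒¬hasTop : ∀ {m} (F : Subset m) → maxS F ≡ nothing → hasTop F ≡ false
maxS≡nothing⇒¬hasTop F eq with hasTop F in top
... | false = refl
... | true  = contradiction (trans (sym eq) (maxFrom-hasTop 0 F top)) λ ()

maxS≡just⇒hasTop : ∀ {m} (F : Subset m) {mx} → maxS F ≡ just mx → ⌊ mx ≟ m ⌋ ≡ hasTop F
maxS≡just⇒hasTop {m} F {mx} eq with hasTop F in top
... | true  = trans (isYes≗does (mx ≟ m))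
                    (dec-true (mx ≟ m) (just-injective (trans (sym eq) (maxFrom-hasTop 0 F top))))
... | false = trans (isYes≗does (mx ≟ m)) (dec-false (mx ≟ m) (<⇒≢ (maxFrom-¬hasTop 0 F top eq)))

module _ (p q : ℕ) where

  schreierᵇ : Maybe ℕ → ℕ → Bool
  schreierᵇ (just mn) s = p * s ≤ᵇ q * mn
  schreierᵇ nothing   _ = false

  isS≡hasTop∧schreierᵇ : ∀ m (F : Subset m) → isS p q m F ≡ hasTop F ∧ schreierᵇ (minS F) ∣ F ∣
  isS≡hasTop∧schreierᵇ m F with minS F | maxS F in eq
  ... | nothing | _       = sym (∧-zeroʳ (hasTop F))
  ... | just mn | nothing = sym (cong (_∧ (p * ∣ F ∣ ≤ᵇ q * mn)) (maxS≡nothing⇒¬hasTop F eq))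
  ... | just mn | just mx =
    trans (∧-comm (p * ∣ F ∣ ≤ᵇ q * mn) _) (cong (_∧ (p * ∣ F ∣ ≤ᵇ q * mn)) (maxS≡just⇒hasTop F eq))

  schreierᵇ-minFrom : ∀ {m} k (F : Subset m) {s} → p ≤ k → s ≤ q → hasTop F ≡ true →
    schreierᵇ (minFrom k F) s ≡ true
  schreierᵇ-minFrom k F {s} p≤k s≤q top with minFrom k F in eq
  ... | nothing = contradiction (trans (sym top) (minFrom≡nothing⇒¬hasTop k F eq)) λ ()
  ... | just x  = Equivalence.to T-≡ (≤⇒≤ᵇ (begin
    p * s ≤⟨ *-mono-≤ (≤-trans p≤k (minFrom-≥ k F eq)) s≤q ⟩
    x * q ≡⟨ *-comm x q ⟩
    q * x ∎))
    where open ≤-Reasoning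

  -- Positions carry the values k, k+1, …, k+m−1 and G lies in the window [w, w+q].
  schreierᵇ-deletePositions : ∀ k w {m} (G F : Subset m) →
    (∀ i → i ∈ G → w ≤ k + toℕ i) → p ≤ w → k + m ≤ suc q + w → 0 < ∣ G ∣ →
    hasTop G ≡ false → disjointᵇ G F ≡ true → hasTop F ≡ true →
    schreierᵇ (minFrom k (deletePositions G F)) ∣ F ∣ ≡ schreierᵇ (minFrom k F) ∣ F ∣
  schreierᵇ-deletePositions k w {m} G F G≥w p≤w k+m≤ 0<∣G∣ topG disjoint topF with w ≤? k
  ... | yes w≤k =
    trans (schreierᵇ-minFrom k (deletePositions G F) p≤k ∣F∣≤q
             (trans (hasTop-deletePositions G F topG) topF))
          (sym (schreierᵇ-minFrom k F p≤k ∣F∣≤q topF))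
    where
    p≤k : p ≤ k
    p≤k = ≤-trans p≤w w≤k
    m≤1+q : m ≤ suc q
    m≤1+q = +-cancelˡ-≤ k m (suc q)
      (≤-trans k+m≤ (≤-trans (+-monoʳ-≤ (suc q) w≤k) (≤-reflexive (+-comm (suc q) k))))
    ∣F∣≤q : ∣ F ∣ ≤ q
    ∣F∣≤q = begin
      ∣ F ∣     ≤⟨ disjoint⇒∣F∣≤∣∁G∣ G F disjoint ⟩
      ∣ ∁ G ∣   ≡⟨ ∣∁p∣≡n∸∣p∣ G ⟩
      m ∸ ∣ G ∣ ≤⟨ ∸-mono m≤1+q 0<∣G∣ ⟩
      q         ∎
      where open ≤-Reasoning
  schreierᵇ-deletePositions k w (true ∷ G) F G≥w _ _ _ _ _ _ | no w≰k =
    contradiction (subst (w ≤_) (+-identityʳ k) (G≥w Fin.zero here)) w≰k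
  schreierᵇ-deletePositions k w (false ∷ G) (true ∷ F) _ _ _ _ _ _ _ | no _ = refl
  schreierᵇ-deletePositions k w (false ∷ G) (false ∷ F) G≥w p≤w k+m≤ 0<∣G∣ topG disjoint topF
    | no _ =
    schreierᵇ-deletePositions (suc k) w G F
      (λ i i∈G → subst (w ≤_) (+-suc k (toℕ i)) (G≥w (Fin.suc i) (there i∈G)))
      p≤w (subst (_≤ suc q + w) (+-suc k _) k+m≤) 0<∣G∣
      (trans (sym (hasTop-∷ false G 0<m)) topG) disjoint (trans (sym (hasTop-∷ false F 0<m)) topF)
    where
    0<m : 0 < _
    0<m = <-≤-trans 0<∣G∣ (∣p∣≤n G)

  isS-deletePositions : ∀ w {m} (G : Subset m) →
    (∀ i → i ∈ G → w ≤ suc (toℕ i)) → p ≤ w → suc m ≤ suc q + w → 0 < ∣ G ∣ → hasTop G ≡ false →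
    ∀ F → disjointᵇ G F ≡ true → isS p q m F ≡ isS p q ∣ ∁ G ∣ (deletePositions G F)
  isS-deletePositions w {m} G G≥w p≤w 1+m≤ 0<∣G∣ topG F disjoint = begin
    isS p q m F
      ≡⟨ isS≡hasTop∧schreierᵇ m F ⟩
    hasTop F ∧ schreierᵇ (minS F) ∣ F ∣
      ≡⟨ minimum-condition-preserved ⟩
    hasTop F ∧ schreierᵇ (minS F′) ∣ F ∣
      ≡⟨ cong₂ (λ t s → t ∧ schreierᵇ (minS F′) s) (hasTop-deletePositions G F topG)
               (∣deletePositions∣ G F disjoint) ⟨
    hasTop F′ ∧ schreierᵇ (minS F′) ∣ F′ ∣
      ≡⟨ isS≡hasTop∧schreierᵇ ∣ ∁ G ∣ F′ ⟨
    isS p q ∣ ∁ G ∣ F′ ∎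
    where
    open ≡-Reasoning
    F′ : Subset ∣ ∁ G ∣
    F′ = deletePositions G F
    minimum-condition-preserved :
      hasTop F ∧ schreierᵇ (minS F) ∣ F ∣ ≡ hasTop F ∧ schreierᵇ (minS F′) ∣ F ∣
    minimum-condition-preserved with hasTop F in topF
    ... | false = refl
    ... | true  = sym (schreierᵇ-deletePositions 1 w G F G≥w p≤w 1+m≤ 0<∣G∣ topG disjoint topF)

lemma2p1 : (p q n : ℕ) → 1 ≤ p → 1 ≤ q → p + q ≤ n → (G : Subset n) → InWindow q n G → NonemptyS G →
    cardA p q n G ≡ cardS p q (n ∸ ∣ G ∣)
lemma2p1 p q n _ _ p+q≤n G window (i , i∈G) = begin
  cardA p q n G
    ≡⟨ countSubsets-disjoint G (isS p q n) (isS p q ∣ ∁ G ∣)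
         (isS-deletePositions p q (n ∸ q) G (λ j → proj₁ ∘ window j) p≤n∸q 1+n≤1+q+[n∸q] 0<∣G∣
           (window⇒¬hasTop q G window)) ⟩
  cardS p q ∣ ∁ G ∣
    ≡⟨ cong (cardS p q) (∣∁p∣≡n∸∣p∣ G) ⟩
  cardS p q (n ∸ ∣ G ∣) ∎
  where
  open ≡-Reasoning
  p≤n∸q : p ≤ n ∸ q
  p≤n∸q = m+n≤o⇒m≤o∸n p p+q≤n
  1+n≤1+q+[n∸q] : suc n ≤ suc q + (n ∸ q)
  1+n≤1+q+[n∸q] = s≤s (m≤n+m∸n n q)
  0<∣G∣ : 0 < ∣ G ∣
  0<∣G∣ = ≤-<-trans z≤n (x∈p⇒∣p-x∣<∣p∣ i∈G)
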